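{- If $G$ is a graph such that every vertex has at least one twin, then $G$ is complementary vanishing.
   Context: Two distinct vertices $u,v$ of $G$ are twins if $N(u)\setminus\{v\}=N(v)\setminus\{u\}$ (twins may be adjacent or nonadjacent), where $N(x)$ is the open neighborhood. For a graph $G$ with vertex set $\{v_1,\dots,v_n\}$, $\mathcal{S}(G)$ is the set of real symmetric $n\times n$ matrices $A=[a_{i,j}]$ such that for $i\neq j$, $a_{i,j}\neq 0$ if and only if $v_iv_j\in E(G)$ (diagonal entries are unrestricted). A graph $G$ is complementary vanishing if there exist $A\in\mathcal{S}(G)$ and $B\in\mathcal{S}(\overline{G})$ with $AB=O$, where $\overline{G}$ is the complement of $G$. -}

module Defs where

open import Level using (Level; suc; _⊔_)
open import Data.Nat using (ℕ)
open import Data.Fin using (Fin; _≟_)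
open import Data.Bool using (Bool; true; false; not)
open import Data.Sum using (_⊎_)
open import Data.Empty using (⊥-elim)
open import Data.Product using (_×_; Σ; ∃; _,_)
open import Relation.Nullary using (¬_; yes; no)
open import Relation.Binary.PropositionalEquality using (_≡_; _≢_)
open import Function.Bundles using (_⇔_)
open import Algebra.Bundles using (CommutativeRing)
import Algebra.Properties.Monoid.Sum as MonoidSum

record Graph (n : ℕ) : Set where
  field
    adj    : Fin n → Fin n → Bool
    sym    : ∀ i j → adj i j ≡ adj j i
    irrefl : ∀ i → adj i i ≡ false
open Graph public

_∈N[_]_ : ∀ {n} → Fin n → Graph n → Fin n → Set
w ∈N[ G ] u = adj G u w ≡ true

complement : ∀ {n} → Graph n → Graph n
complement {n} G = record { adj = cadj ; sym = csym ; irrefl = cirr }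
  where
  cadj : Fin n → Fin n → Bool
  cadj i j with i ≟ j
  ... | yes _ = false
  ... | no  _ = not (adj G i j)
  csym : ∀ i j → cadj i j ≡ cadj j i
  csym i j with i ≟ j | j ≟ i
  ... | yes _ | yes _ = _≡_.refl
  ... | yes p | no ¬q = ⊥-elim (¬q (Relation.Binary.PropositionalEquality.sym p))
  ... | no ¬p | yes q = ⊥-elim (¬p (Relation.Binary.PropositionalEquality.sym q))
  ... | no _  | no _  = Relation.Binary.PropositionalEquality.cong not (sym G i j)
  cirr : ∀ i → cadj i i ≡ false
  cirr i with i ≟ i
  ... | yes _ = _≡_.refl
  ... | no ¬p = ⊥-elim (¬p _≡_.refl)

Twins : ∀ {n} → Graph n → Fin n → Fin n → Set
Twins G u v =
  u ≢ v × (∀ w → ((w ∈N[ G ] u) × w ≢ v) ⇔ ((w ∈N[ G ] v) × w ≢ u))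

-- The real numbers, axiomatised as a complete ordered field
-- (unique up to isomorphism), over a commutative ring with setoid equality.

record RealField c ℓ : Set (suc (c ⊔ ℓ)) where
  field
    commutativeRing : CommutativeRing c ℓ
  open CommutativeRing commutativeRing public
  field
    _≤_       : Carrier → Carrier → Set ℓ
    ≤-refl    : ∀ {x y} → x ≈ y → x ≤ y
    ≤-antisym : ∀ {x y} → x ≤ y → y ≤ x → x ≈ y
    ≤-trans   : ∀ {x y z} → x ≤ y → y ≤ z → x ≤ z
    ≤-total   : ∀ x y → (x ≤ y) ⊎ (y ≤ x)
    ≤-resp-≈  : ∀ {x x′ y y′} → x ≈ x′ → y ≈ y′ → x ≤ y → x′ ≤ y′
    +-mono-≤  : ∀ {x y} z → x ≤ y → (x + z) ≤ (y + z)
    *-nonneg  : ∀ {x y} → 0# ≤ x → 0# ≤ y → 0# ≤ (x * y)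
    0≉1       : ¬ (0# ≈ 1#)
    inverse   : ∀ x → ¬ (x ≈ 0#) → ∃ λ y → (x * y) ≈ 1#
    complete  : (P : Carrier → Set c) → (∃ λ x → P x) →
                (∃ λ b → ∀ x → P x → x ≤ b) →
                ∃ λ s → (∀ x → P x → x ≤ s) ×
                        (∀ b → (∀ x → P x → x ≤ b) → s ≤ b)

module _ {c ℓ} (ℝ : RealField c ℓ) where
  open RealField ℝ
  open MonoidSum +-monoid using (sum)

  Matrix : ℕ → Set c
  Matrix n = Fin n → Fin n → Carrier

  _·_ : ∀ {n} → Matrix n → Matrix n → Matrix n
  (A · B) i j = sum (λ k → A i k * B k j)

  IsZero : ∀ {n} → Matrix n → Set ℓ
  IsZero A = ∀ i j → A i j ≈ 0#

  InS : ∀ {n} → Graph n → Matrix n → Set ℓ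
  InS G A = (∀ i j → A i j ≈ A j i) ×
            (∀ i j → i ≢ j → (¬ (A i j ≈ 0#)) ⇔ (adj G i j ≡ true))

  ComplementaryVanishing : ∀ {n} → Graph n → Set (c ⊔ ℓ)
  ComplementaryVanishing G =
    ∃ λ A → ∃ λ B → InS G A × InS (complement G) B × IsZero (A · B)

{-# OPTIONS --safe #-}
module Submission where

-- Choose a twin t(u) of every vertex u. All twins of a vertex are adjacent to it or all are not,
-- so the 0/1 matrix N with the adjacency of G off the diagonal and N(i,i) = [i ~ t(i)] is
-- symmetric and has equal rows at twins. Take A = N and B = D (J − N) D with D = diag(d) for a
-- nowhere-zero d: the patterns of A and B are those of G and of its complement, and
-- (AB)(i,j) = d_j Σ_k σ(k) d_k where σ(k) = N(i,k) (1 − N(k,j)) satisfies σ ∘ t = σ. So AB = 0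
-- as soon as d is orthogonal to every t-invariant vector, as d = λ − t_*λ is for any λ, where
-- (t_*λ)_k = Σ_{t(u)=k} λ_u. For λ_u = 2^u this d vanishes nowhere: t has no fixed points, and
-- 2^k is not a sum of distinct powers of two other than 2^k.

open import Defs
open import Data.Nat using (ℕ)
open import Data.Fin using (Fin)
open import Data.Product using (∃)

open import Algebra.Bundles using (CommutativeRing)
open import Data.Bool using (Bool; true; false; not; if_then_else_; _∧_)
open import Data.Fin using (zero; suc; toℕ; _≟_)
open import Data.Nat as ℕ using (_^_)
open import Data.Nat.Properties using (even≢odd; *-cancelˡ-≡)
open import Data.Product using (_,_; proj₁; proj₂)
open import Data.Sum using (inj₁; inj₂)
open import Function using (_∘_; case_of_)
open import Function.Bundles using (_⇔_; mk⇔; Equivalence)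
open import Relation.Nullary using (¬_; does; yes; no; contradiction)
open import Relation.Nullary.Decidable using (dec-true; dec-false)
open import Relation.Binary.PropositionalEquality as ≡ using (_≡_; _≢_; refl; cong)

bit : Bool → ℕ
bit false = 0
bit true  = 1

fromBits : ∀ {n} → (Fin n → Bool) → ℕ
fromBits {ℕ.zero}  p = 0
fromBits {ℕ.suc n} p = bit (p zero) ℕ.+ 2 ℕ.* fromBits (p ∘ suc)

fromBits-≢-pow2 : ∀ {n} (p : Fin n → Bool) k → p k ≡ false → fromBits p ≢ 2 ^ toℕ k
fromBits-≢-pow2 {ℕ.suc n} p k pk eq with p zero in p₀
fromBits-≢-pow2 p zero    pk  eq | true  = contradiction (≡.trans (≡.sym p₀) pk) λ ()
fromBits-≢-pow2 p zero    pk  eq | false = even≢odd (fromBits (p ∘ suc)) 0 eq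
fromBits-≢-pow2 p (suc k) pk  eq | true  = even≢odd (2 ^ toℕ k) (fromBits (p ∘ suc)) (≡.sym eq)
fromBits-≢-pow2 p (suc k) pk  eq | false =
  fromBits-≢-pow2 (p ∘ suc) k pk (*-cancelˡ-≡ (fromBits (p ∘ suc)) (2 ^ toℕ k) 2 eq)

module IndicatorSums {c ℓ} (R : CommutativeRing c ℓ) where
  open CommutativeRing R renaming (sym to ≈-sym; trans to ≈-trans) hiding (zero)
  open import Algebra.Properties.Ring ring using (-1*x≈-x; -‿distribʳ-*)
  open import Algebra.Properties.Semiring.Sum semiring
    using (sum; sum-cong-≋; sum-replicate-zero; ∑-comm; ∑-distrib-+; *-distribˡ-sum)
  open import Algebra.Properties.CommutativeSemigroup *-commutativeSemigroup using (x∙yz≈y∙xz)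
  open import Relation.Binary.Reasoning.Setoid setoid

  χ : Bool → Carrier
  χ false = 0#
  χ true  = 1#

  χ-∧ : ∀ a b → χ (a ∧ b) ≈ χ a * χ b
  χ-∧ false b = ≈-sym (zeroˡ (χ b))
  χ-∧ true  b = ≈-sym (*-identityˡ (χ b))

  ∑-δ : ∀ {n} (a : Fin n) (f : Fin n → Carrier) → sum (λ k → χ (does (a ≟ k)) * f k) ≈ f a
  ∑-δ {ℕ.suc n} zero f = begin
    1# * f zero + sum (λ k → 0# * f (suc k))
                                             ≈⟨ +-cong (*-identityˡ (f zero)) (sum-cong-≋ (λ k → zeroˡ (f (suc k)))) ⟩
    f zero + sum {n} (λ _ → 0#)              ≈⟨ +-congˡ (sum-replicate-zero n) ⟩
    f zero + 0#                              ≈⟨ +-identityʳ (f zero) ⟩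
    f zero                                   ∎
  ∑-δ (suc a) f = begin
    0# * f zero + sum (λ k → χ (does (a ≟ k)) * f (suc k)) ≈⟨ +-cong (zeroˡ (f zero)) (∑-δ a (f ∘ suc)) ⟩
    0# + f (suc a)                                           ≈⟨ +-identityˡ (f (suc a)) ⟩
    f (suc a)                                                ∎

  sum-neg : ∀ {n} (g : Fin n → Carrier) → sum (λ k → - g k) ≈ - sum g
  sum-neg g = begin
    sum (λ k → - g k)      ≈⟨ sum-cong-≋ (λ k → ≈-sym (-1*x≈-x (g k))) ⟩
    sum (λ k → - 1# * g k) ≈⟨ *-distribˡ-sum (- 1#) g ⟨
    - 1# * sum g           ≈⟨ -1*x≈-x (sum g) ⟩
    - sum g                ∎

  push : ∀ {m n} → (Fin m → Fin n) → (Fin m → Carrier) → Fin n → Carrier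
  push t w k = sum (λ u → χ (does (t u ≟ k)) * w u)

  ∑-*-push : ∀ {m n} (t : Fin m → Fin n) (w : Fin m → Carrier) (f : Fin n → Carrier) →
             sum (λ k → f k * push t w k) ≈ sum (λ u → f (t u) * w u)
  ∑-*-push t w f = begin
    sum (λ k → f k * push t w k)                             ≈⟨ sum-cong-≋ (λ k → *-distribˡ-sum (f k) (λ u → χ (does (t u ≟ k)) * w u)) ⟩
    sum (λ k → sum (λ u → f k * (χ (does (t u ≟ k)) * w u))) ≈⟨ ∑-comm (λ k u → f k * (χ (does (t u ≟ k)) * w u)) ⟩
    sum (λ u → sum (λ k → f k * (χ (does (t u ≟ k)) * w u))) ≈⟨ sum-cong-≋ (λ u → sum-cong-≋ (λ k → x∙yz≈y∙xz (f k) _ (w u))) ⟩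
    sum (λ u → sum (λ k → χ (does (t u ≟ k)) * (f k * w u))) ≈⟨ sum-cong-≋ (λ u → ∑-δ (t u) (λ k → f k * w u)) ⟩
    sum (λ u → f (t u) * w u)                                ∎

  ∑-*-[id-push]≈0 : ∀ {n} (t : Fin n → Fin n) (w f : Fin n → Carrier) → (∀ u → f (t u) ≈ f u) →
                    sum (λ k → f k * (w k - push t w k)) ≈ 0#
  ∑-*-[id-push]≈0 t w f f∘t≈f = begin
    sum (λ k → f k * (w k - push t w k))                     ≈⟨ sum-cong-≋ (λ k → distrib-- (f k) (w k) (push t w k)) ⟩
    sum (λ k → f k * w k + - (f k * push t w k))             ≈⟨ ∑-distrib-+ (λ k → f k * w k) (λ k → - (f k * push t w k)) ⟩
    sum (λ k → f k * w k) + sum (λ k → - (f k * push t w k)) ≈⟨ +-congˡ (sum-neg (λ k → f k * push t w k)) ⟩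
    sum (λ k → f k * w k) - sum (λ k → f k * push t w k)     ≈⟨ +-congˡ (-‿cong (∑-*-push t w f)) ⟩
    sum (λ k → f k * w k) - sum (λ u → f (t u) * w u)        ≈⟨ +-congˡ (-‿cong (sum-cong-≋ (λ u → *-congʳ (f∘t≈f u)))) ⟩
    sum (λ k → f k * w k) - sum (λ u → f u * w u)            ≈⟨ -‿inverseʳ (sum (λ k → f k * w k)) ⟩
    0#                                                       ∎
    where
    distrib-- : ∀ x y z → x * (y - z) ≈ x * y + - (x * z)
    distrib-- x y z = ≈-trans (distribˡ x y (- z)) (+-congˡ (≈-sym (-‿distribʳ-* x z)))

module RealFieldLemmas {c ℓ} (ℝ : RealField c ℓ) where
  open RealField ℝ renaming (refl to ≈-refl; sym to ≈-sym; trans to ≈-trans) hiding (zero)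
  open IndicatorSums commutativeRing
  open import Algebra.Properties.Ring ring using (-1*x≈-x; -‿involutive; x∙y⁻¹≈ε⇒x≈y; +-cancelˡ)
  open import Algebra.Properties.Semiring.Mult semiring using (_×_; ×-homo-+; ×1-homo-*)
  open import Algebra.Properties.Semiring.Sum semiring using (sum; sum-cong-≋; *-distribˡ-sum)
  open import Algebra.Properties.CommutativeSemigroup *-commutativeSemigroup using (x∙yz≈y∙xz)
  open import Relation.Binary.Reasoning.Setoid setoid

  0≤1 : 0# ≤ 1#
  0≤1 with ≤-total 0# 1#
  ... | inj₁ 0≤1 = 0≤1
  ... | inj₂ 1≤0 = ≤-resp-≈ ≈-refl (-1*-1≈1) (*-nonneg 0≤-1 0≤-1)
    where
    0≤-1 : 0# ≤ (- 1#)
    0≤-1 = ≤-resp-≈ (-‿inverseʳ 1#) (+-identityˡ (- 1#)) (+-mono-≤ (- 1#) 1≤0)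
    -1*-1≈1 : - 1# * - 1# ≈ 1#
    -1*-1≈1 = ≈-trans (-1*x≈-x (- 1#)) (-‿involutive 1#)

  1≤suc×1 : ∀ m → 1# ≤ (ℕ.suc m × 1#)
  1≤suc×1 ℕ.zero    = ≤-refl (≈-sym (+-identityʳ 1#))
  1≤suc×1 (ℕ.suc m) = ≤-resp-≈ (+-identityˡ 1#) (+-comm (ℕ.suc m × 1#) 1#)
                               (+-mono-≤ 1# (≤-trans 0≤1 (1≤suc×1 m)))

  suc×1≉0 : ∀ m → ¬ (ℕ.suc m × 1# ≈ 0#)
  suc×1≉0 m h = 0≉1 (≤-antisym 0≤1 (≤-resp-≈ ≈-refl h (1≤suc×1 m)))

  ×1-injective : ∀ m k → m × 1# ≈ k × 1# → m ≡ k
  ×1-injective ℕ.zero    ℕ.zero    _ = refl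
  ×1-injective ℕ.zero    (ℕ.suc k) h = contradiction (≈-sym h) (suc×1≉0 k)
  ×1-injective (ℕ.suc m) ℕ.zero    h = contradiction h (suc×1≉0 m)
  ×1-injective (ℕ.suc m) (ℕ.suc k) h = cong ℕ.suc (×1-injective m k (+-cancelˡ 1# (m × 1#) (k × 1#) h))

  *-≉0 : ∀ {x y} → ¬ (x ≈ 0#) → ¬ (y ≈ 0#) → ¬ (x * y ≈ 0#)
  *-≉0 {x} {y} x≉0 y≉0 xy≈0 with inverse x x≉0
  ... | x⁻¹ , xx⁻¹≈1 = y≉0 (begin
    y              ≈⟨ *-identityˡ y ⟨
    1# * y         ≈⟨ *-congʳ xx⁻¹≈1 ⟨
    (x * x⁻¹) * y  ≈⟨ *-congʳ (*-comm x x⁻¹) ⟩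
    (x⁻¹ * x) * y  ≈⟨ *-assoc x⁻¹ x y ⟩
    x⁻¹ * (x * y)  ≈⟨ *-congˡ xy≈0 ⟩
    x⁻¹ * 0#       ≈⟨ zeroʳ x⁻¹ ⟩
    0#             ∎)

  pow2 : ℕ → Carrier
  pow2 m = (2 ^ m) × 1#

  fromBits×1 : ∀ {n} (p : Fin n → Bool) → fromBits p × 1# ≈ sum (λ u → χ (p u) * pow2 (toℕ u))
  fromBits×1 {ℕ.zero}  p = ≈-refl
  fromBits×1 {ℕ.suc n} p = begin
    (bit (p zero) ℕ.+ 2 ℕ.* F) × 1#
      ≈⟨ ×-homo-+ 1# (bit (p zero)) (2 ℕ.* F) ⟩
    bit (p zero) × 1# + (2 ℕ.* F) × 1#
      ≈⟨ +-cong (bit×1 (p zero)) (×1-homo-* 2 F) ⟩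
    χ (p zero) * pow2 0 + 2 × 1# * (F × 1#)
      ≈⟨ +-congˡ (*-congˡ (fromBits×1 (p ∘ suc))) ⟩
    χ (p zero) * pow2 0 + 2 × 1# * sum (λ u → χ (p (suc u)) * pow2 (toℕ u))
      ≈⟨ +-congˡ (*-distribˡ-sum (2 × 1#) (λ u → χ (p (suc u)) * pow2 (toℕ u))) ⟩
    χ (p zero) * pow2 0 + sum (λ u → 2 × 1# * (χ (p (suc u)) * pow2 (toℕ u)))
      ≈⟨ +-congˡ (sum-cong-≋ double) ⟩
    χ (p zero) * pow2 0 + sum (λ u → χ (p (suc u)) * pow2 (ℕ.suc (toℕ u)))
      ∎
    where
    F : ℕ
    F = fromBits (p ∘ suc)
    bit×1 : ∀ b → bit b × 1# ≈ χ b * (1 × 1#)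
    bit×1 false = ≈-sym (zeroˡ (1 × 1#))
    bit×1 true  = ≈-sym (*-identityˡ (1 × 1#))
    double : ∀ (u : Fin n) → 2 × 1# * (χ (p (suc u)) * pow2 (toℕ u)) ≈ χ (p (suc u)) * pow2 (ℕ.suc (toℕ u))
    double u = ≈-trans (x∙yz≈y∙xz (2 × 1#) (χ (p (suc u))) (pow2 (toℕ u)))
                       (*-congˡ (≈-sym (×1-homo-* 2 (2 ^ toℕ u))))

  pow2-push-≉0 : ∀ {n} (t : Fin n → Fin n) → (∀ k → t k ≢ k) →
                 ∀ k → ¬ (pow2 (toℕ k) - push t (pow2 ∘ toℕ) k ≈ 0#)
  pow2-push-≉0 t t-fixpoint-free k h =
    fromBits-≢-pow2 fibre k (dec-false (t k ≟ k) (t-fixpoint-free k))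
      (×1-injective (fromBits fibre) (2 ^ toℕ k)
        (≈-trans (fromBits×1 fibre) (≈-sym (x∙y⁻¹≈ε⇒x≈y (pow2 (toℕ k)) (push t (pow2 ∘ toℕ) k) h))))
    where
    fibre : Fin _ → Bool
    fibre u = does (t u ≟ k)

≡true⇔⇒≡ : ∀ {a b} → (a ≡ true → b ≡ true) → (b ≡ true → a ≡ true) → a ≡ b
≡true⇔⇒≡ {false} {false} _ _ = refl
≡true⇔⇒≡ {false} {true}  _ b⇒a = b⇒a refl
≡true⇔⇒≡ {true}  {false} a⇒b _ = ≡.sym (a⇒b refl)
≡true⇔⇒≡ {true}  {true}  _ _ = refl

module _ {n} (G : Graph n) where
  open Equivalence

  Twins-sym : ∀ {u v} → Twins G u v → Twins G v u
  Twins-sym (u≢v , N≡N) = u≢v ∘ ≡.sym , λ w → mk⇔ (from (N≡N w)) (to (N≡N w))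

  Twins-adj : ∀ {u v w} → Twins G u v → w ≢ u → w ≢ v → adj G u w ≡ adj G v w
  Twins-adj {w = w} (_ , N≡N) w≢u w≢v =
    ≡true⇔⇒≡ (λ uw → proj₁ (to (N≡N w) (uw , w≢v))) (λ vw → proj₁ (from (N≡N w) (vw , w≢u)))

  adj-twin⇒adj-twin : ∀ {k a b} → Twins G k a → Twins G k b → adj G k a ≡ true → adj G k b ≡ true
  adj-twin⇒adj-twin {k} {a} {b} (_ , Nk≡Na) (k≢b , Nk≡Nb) ka with a ≟ b
  ... | yes refl = ka
  ... | no  a≢b  = proj₁ (from (Nk≡Na b) (ab , k≢b ∘ ≡.sym))
    where
    ab : adj G a b ≡ true
    ab = ≡.trans (sym G a b) (proj₁ (to (Nk≡Nb a) (ka , a≢b)))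

  adj-twins : ∀ {k a b} → Twins G k a → Twins G k b → adj G k a ≡ adj G k b
  adj-twins ka kb = ≡true⇔⇒≡ (adj-twin⇒adj-twin ka kb) (adj-twin⇒adj-twin kb ka)

  adj-complement : ∀ {i j} → i ≢ j → adj (complement G) i j ≡ not (adj G i j)
  adj-complement {i} {j} i≢j with i ≟ j
  ... | yes i≡j = contradiction i≡j i≢j
  ... | no  _   = refl

module TwinNeighbourhood {n} (G : Graph n) (twin-of : ∀ u → ∃ (Twins G u)) where
  open ≡.≡-Reasoning

  t : Fin n → Fin n
  t = proj₁ ∘ twin-of

  t-twin : ∀ u → Twins G u (t u)
  t-twin = proj₂ ∘ twin-of

  twinNbhd : Fin n → Fin n → Bool
  twinNbhd i k = if does (i ≟ k) then adj G i (t i) else adj G i k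

  twinNbhd-off : ∀ {i k} → i ≢ k → twinNbhd i k ≡ adj G i k
  twinNbhd-off {i} {k} i≢k rewrite dec-false (i ≟ k) i≢k = refl

  twinNbhd-refl : ∀ i → twinNbhd i i ≡ adj G i (t i)
  twinNbhd-refl i rewrite dec-true (i ≟ i) refl = refl

  twinNbhd-diag : ∀ {i k} → Twins G i k → twinNbhd i i ≡ adj G i k
  twinNbhd-diag {i} ik = ≡.trans (twinNbhd-refl i) (adj-twins G (t-twin i) ik)

  twinNbhd-sym : ∀ i k → twinNbhd i k ≡ twinNbhd k i
  twinNbhd-sym i k = case i ≟ k of λ where
    (yes refl) → refl
    (no  i≢k)  → ≡.trans (twinNbhd-off i≢k) (≡.trans (sym G i k) (≡.sym (twinNbhd-off (i≢k ∘ ≡.sym))))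

  twinNbhd-twinʳ : ∀ i {k k′} → Twins G k k′ → twinNbhd i k ≡ twinNbhd i k′
  twinNbhd-twinʳ i {k} {k′} kk′ = case ((i ≟ k) , (i ≟ k′)) of λ where
    (yes refl , _)        → ≡.trans (twinNbhd-diag kk′) (≡.sym (twinNbhd-off (proj₁ kk′)))
    (no  i≢k  , yes refl) → ≡.trans (twinNbhd-off i≢k) (≡.sym (twinNbhd-diag (Twins-sym G kk′)))
    (no  i≢k  , no  i≢k′) → begin
      twinNbhd i k   ≡⟨ twinNbhd-off i≢k ⟩
      adj G i k      ≡⟨ sym G i k ⟩
      adj G k i      ≡⟨ Twins-adj G kk′ i≢k i≢k′ ⟩
      adj G k′ i     ≡⟨ sym G k′ i ⟩
      adj G i k′     ≡⟨ twinNbhd-off i≢k′ ⟨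
      twinNbhd i k′  ∎

  twinNbhd-twinˡ : ∀ {k k′} j → Twins G k k′ → twinNbhd k j ≡ twinNbhd k′ j
  twinNbhd-twinˡ {k} {k′} j kk′ =
    ≡.trans (twinNbhd-sym k j) (≡.trans (twinNbhd-twinʳ j kk′) (twinNbhd-sym j k′))

  twinNbhdᶜ : Fin n → Fin n → Bool
  twinNbhdᶜ i j = not (twinNbhd i j)

  twinNbhdᶜ-sym : ∀ i j → twinNbhdᶜ i j ≡ twinNbhdᶜ j i
  twinNbhdᶜ-sym i j = cong not (twinNbhd-sym i j)

  twinNbhdᶜ-off : ∀ {i j} → i ≢ j → twinNbhdᶜ i j ≡ adj (complement G) i j
  twinNbhdᶜ-off i≢j = ≡.trans (cong not (twinNbhd-off i≢j)) (≡.sym (adj-complement G i≢j))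

  twinNbhd-∧-twinNbhdᶜ-invariant : ∀ i j u →
    (twinNbhd i (t u) ∧ twinNbhdᶜ (t u) j) ≡ (twinNbhd i u ∧ twinNbhdᶜ u j)
  twinNbhd-∧-twinNbhdᶜ-invariant i j u =
    ≡.cong₂ (λ a b → a ∧ not b) (≡.sym (twinNbhd-twinʳ i (t-twin u))) (≡.sym (twinNbhd-twinˡ j (t-twin u)))

  t-fixpoint-free : ∀ k → t k ≢ k
  t-fixpoint-free k = proj₁ (t-twin k) ∘ ≡.sym

module PatternMatrices {c ℓ} (ℝ : RealField c ℓ) where
  open RealField ℝ renaming (refl to ≈-refl; sym to ≈-sym; trans to ≈-trans) hiding (zero)
  open IndicatorSums commutativeRing using (χ; χ-∧)
  open RealFieldLemmas ℝ using (*-≉0)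
  open import Algebra.Properties.Semiring.Sum semiring using (sum; sum-cong-≋; *-distribʳ-sum)
  open import Relation.Binary.Reasoning.Setoid setoid

  χ≉0⇔≡true : ∀ b → (¬ (χ b ≈ 0#)) ⇔ (b ≡ true)
  χ≉0⇔≡true false = mk⇔ (λ 0≉0 → contradiction ≈-refl 0≉0) λ ()
  χ≉0⇔≡true true  = mk⇔ (λ _ → refl) (λ _ 1≈0 → 0≉1 (≈-sym 1≈0))

  InS-χ : ∀ {n} (H : Graph n) (P : Fin n → Fin n → Bool) →
          (∀ i j → P i j ≡ P j i) → (∀ {i j} → i ≢ j → P i j ≡ adj H i j) →
          InS ℝ H (λ i j → χ (P i j))
  InS-χ H P P-sym P-off =
    (λ i j → reflexive (cong χ (P-sym i j))) ,
    (λ i j i≢j → ≡.subst (λ b → (¬ (χ (P i j) ≈ 0#)) ⇔ (b ≡ true)) (P-off i≢j) (χ≉0⇔≡true (P i j)))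

  InS-scale : ∀ {n} {H : Graph n} {M : Matrix ℝ n} (d : Fin n → Carrier) → (∀ k → ¬ (d k ≈ 0#)) →
              InS ℝ H M → InS ℝ H (λ i j → M i j * (d i * d j))
  InS-scale {M = M} d d≉0 (M-sym , M-pattern) =
    (λ i j → *-cong (M-sym i j) (*-comm (d i) (d j))) ,
    (λ i j i≢j → let open Equivalence (M-pattern i j i≢j) in
      mk⇔ (λ h → to (λ M≈0 → h (≈-trans (*-congʳ M≈0) (zeroˡ (d i * d j)))))
          (λ ij → *-≉0 (from ij) (*-≉0 (d≉0 i) (d≉0 j))))

  ·-χ-scaled : ∀ {n} (P Q : Fin n → Fin n → Bool) (d : Fin n → Carrier) i j →
               _·_ ℝ (λ i k → χ (P i k)) (λ k j → χ (Q k j) * (d k * d j)) i j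
                 ≈ sum (λ k → χ (P i k ∧ Q k j) * d k) * d j
  ·-χ-scaled P Q d i j = begin
    sum (λ k → χ (P i k) * (χ (Q k j) * (d k * d j)))  ≈⟨ sum-cong-≋ regroup ⟩
    sum (λ k → χ (P i k ∧ Q k j) * d k * d j)          ≈⟨ *-distribʳ-sum (d j) (λ k → χ (P i k ∧ Q k j) * d k) ⟨
    sum (λ k → χ (P i k ∧ Q k j) * d k) * d j          ∎
    where
    regroup : ∀ k → χ (P i k) * (χ (Q k j) * (d k * d j)) ≈ χ (P i k ∧ Q k j) * d k * d j
    regroup k = begin
      χ (P i k) * (χ (Q k j) * (d k * d j))  ≈⟨ *-assoc (χ (P i k)) (χ (Q k j)) (d k * d j) ⟨
      χ (P i k) * χ (Q k j) * (d k * d j)    ≈⟨ *-congʳ (χ-∧ (P i k) (Q k j)) ⟨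
      χ (P i k ∧ Q k j) * (d k * d j)        ≈⟨ *-assoc (χ (P i k ∧ Q k j)) (d k) (d j) ⟨
      χ (P i k ∧ Q k j) * d k * d j          ∎

proposition2p8 : ∀ {c ℓ} (ℝ : RealField c ℓ) (n : ℕ) (G : Graph n) →
                 (∀ u → ∃ λ v → Twins G u v) →
                 ComplementaryVanishing ℝ G
proposition2p8 ℝ n G twin-of = A , B , A∈S , B∈S , AB≈0
  where
  open RealField ℝ using (Carrier; setoid; _≈_; 0#; _-_; _*_; zeroˡ; *-congʳ; reflexive; semiring)
  open import Algebra.Properties.Semiring.Sum semiring using (sum)
  open import Relation.Binary.Reasoning.Setoid setoid
  open IndicatorSums (RealField.commutativeRing ℝ) using (χ; push; ∑-*-[id-push]≈0)
  open RealFieldLemmas ℝ using (pow2; pow2-push-≉0)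
  open PatternMatrices ℝ using (InS-χ; InS-scale; ·-χ-scaled)
  open TwinNeighbourhood G twin-of

  d : Fin n → Carrier
  d k = pow2 (toℕ k) - push t (pow2 ∘ toℕ) k

  A B : Matrix ℝ n
  A i k = χ (twinNbhd i k)
  B k j = χ (twinNbhdᶜ k j) * (d k * d j)

  A∈S : InS ℝ G A
  A∈S = InS-χ G twinNbhd twinNbhd-sym twinNbhd-off

  B∈S : InS ℝ (complement G) B
  B∈S = InS-scale {H = complement G} {M = λ k j → χ (twinNbhdᶜ k j)} d (pow2-push-≉0 t t-fixpoint-free)
          (InS-χ (complement G) twinNbhdᶜ twinNbhdᶜ-sym twinNbhdᶜ-off)

  AB≈0 : IsZero ℝ (_·_ ℝ A B)
  AB≈0 i j = begin
    _·_ ℝ A B i j                                          ≈⟨ ·-χ-scaled twinNbhd twinNbhdᶜ d i j ⟩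
    sum (λ k → χ (twinNbhd i k ∧ twinNbhdᶜ k j) * d k) * d j ≈⟨ *-congʳ (∑-*-[id-push]≈0 t (pow2 ∘ toℕ) _ invariant) ⟩
    0# * d j                                               ≈⟨ zeroˡ (d j) ⟩
    0#                                                     ∎
    where
    invariant : ∀ u → χ (twinNbhd i (t u) ∧ twinNbhdᶜ (t u) j) ≈ χ (twinNbhd i u ∧ twinNbhdᶜ u j)
    invariant u = reflexive (cong χ (twinNbhd-∧-twinNbhdᶜ-invariant i j u))
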